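{- Let $a,b\in\mathbb{N}$ with $b\le a$. Then there exist $n,k\in\mathbb{N}$ with $k\le n$ such that for every $2$-coloring of the edges of $B_{n,k}$ there exists a set of vertices of $B_{n,k}$ whose induced subgraph is isomorphic to $B_{a,b}$ and all of whose edges receive the same color (an induced monochromatic $B_{a,b}$).
   Context: For $n\in\mathbb{N}$ write $[n]=\{1,\dots,n\}$, and for a set $X$ write $\binom{X}{k}$ for the set of $k$-element subsets of $X$. For $k\le n$, $B_{n,k}$ denotes the bipartite graph with left vertex set $[n]$, right vertex set $\binom{[n]}{k}$, and edge set $\{(x,X)\in[n]\times\binom{[n]}{k} : x\in X\}$. A subgraph $H=(V',E')$ of a graph $G=(V,E)$ with $V'\subseteq V$ is induced if $E'$ consists of all edges of $G$ with both endpoints in $V'$. A $2$-coloring of the edges is any map from the edge set to a $2$-element set of colors. -}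

module Defs where

open import Data.Nat using (ℕ)
open import Data.Bool using (Bool)
open import Data.Fin using (Fin)
open import Data.Fin.Subset using (Subset; _∈_; ∣_∣)
open import Data.Sum using (_⊎_; inj₁; inj₂)
open import Data.Product using (Σ; _×_; proj₁)
open import Data.Empty using (⊥)
open import Relation.Binary.PropositionalEquality using (_≡_)
open import Function.Definitions using (Injective)
open import Function.Bundles using (_⇔_)

KSubset : ℕ → ℕ → Set
KSubset n k = Σ (Subset n) (λ X → ∣ X ∣ ≡ k)

-- vertex set of B_{n,k}: left vertices [n], right vertices (n choose k)
Vertex : ℕ → ℕ → Set
Vertex n k = Fin n ⊎ KSubset n k

Adj : ∀ {n k} → Vertex n k → Vertex n k → Set
Adj (inj₁ x) (inj₂ X) = x ∈ proj₁ X
Adj (inj₂ X) (inj₁ x) = x ∈ proj₁ X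
Adj (inj₁ _) (inj₁ _) = ⊥
Adj (inj₂ _) (inj₂ _) = ⊥

Colouring : ℕ → ℕ → Set
Colouring n k = (x : Fin n) (X : KSubset n k) → x ∈ proj₁ X → Bool

edgeColour : ∀ {n k} → Colouring n k → (u v : Vertex n k) → Adj u v → Bool
edgeColour c (inj₁ x) (inj₂ X) p = c x X p
edgeColour c (inj₂ X) (inj₁ x) p = c x X p

-- an induced copy of B_{a,b} in B_{n,k}: an injective vertex map whose image
-- induces a subgraph isomorphic to B_{a,b} via the map, i.e. adjacency is
-- preserved and reflected
IsInducedEmbedding : ∀ {a b n k} → (Vertex a b → Vertex n k) → Set
IsInducedEmbedding {a} {b} f =
  Injective _≡_ _≡_ f × ((u v : Vertex a b) → Adj u v ⇔ Adj (f u) (f v))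

InducedMonoCopy : (a b : ℕ) → ∀ {n k} → Colouring n k → Set
InducedMonoCopy a b {n} {k} c =
  Σ (Vertex a b → Vertex n k) λ f →
    IsInducedEmbedding f ×
    Σ Bool λ col → (u v : Vertex a b) (p : Adj (f u) (f v)) →
      edgeColour c (f u) (f v) p ≡ col

-- A colouring of B_{n,k} gives, for every position i < k, a 2-colouring of the k-subsets of [n]:
-- the colour of the edge from the i-th smallest element of X to X. Applying Ramsey's theorem
-- for k-subsets once per position yields a large set H ⊆ [n] on whose k-subsets each of these
-- colourings is constant, say with colour v i at position i. With k = 2b, some colour c occurs
-- at b positions. Now embed B_{a,b} into B_{n,k} restricted to H: spread the elements of [a]
-- out through H with k unused elements of H before each of them and after the last one, and
-- complete a b-subset Y of [a] to a k-subset of H by placing the elements of Y at the positions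
-- of colour c and filling the other positions with unused elements of H. Every edge of the copy
-- then has colour c, and the fillers never belong to the image of [a], so the copy is induced.
module Submission where

open import Data.Bool using (Bool; true; false; not)
open import Data.Fin using (Fin; zero; suc)
open import Data.Fin.Subset using (Subset; ∣_∣; ⁅_⁆; _∪_)
  renaming (_∈_ to _∈ₛ_; _∉_ to _∉ₛ_; ⊥ to ∅)
open import Data.Fin.Subset.Properties
  using (_∈?_; x∈p∪q⁺; x∈p∪q⁻; x∈⁅x⁆; x∈⁅y⁆⇒x≡y; ∉⊥; ∪-identityˡ; ∣⊥∣≡0; ⊆-antisym)
open import Data.List using (List; []; _∷_; length; map; zip; replicate; take; _++_; applyUpTo; allFin)
open import Data.List.Properties
  using (length-++; map-++; length-replicate; length-map; length-applyUpTo; length-take; length-tabulate)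
open import Data.List.Membership.Propositional using (_∈_; _∉_)
open import Data.List.Membership.Propositional.Properties using (∈-++⁺ʳ; ∈-++⁻; ∈-map⁺)
open import Data.List.Relation.Unary.All as All using ()
open import Data.List.Relation.Unary.AllPairs as AllPairs using ([]; _∷_)
open import Data.List.Relation.Unary.Any using (here; there)
open import Data.List.Relation.Unary.Unique.Propositional using (Unique)
open import Data.List.Relation.Unary.Unique.Propositional.Properties using (Unique[x∷xs]⇒x∉xs; allFin⁺)
open import Data.List.Relation.Binary.Sublist.Propositional
  using (_⊆_; []; _∷_; _∷ʳ_; ⊆-trans; lookup; minimum)
open import Data.List.Relation.Binary.Sublist.Propositional.Properties using (All-resp-⊆; ++⁺; ++⁺ˡ; take-⊆)
open import Data.Maybe using (Maybe; just; nothing; maybe)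
open import Data.Nat using (ℕ; zero; suc; pred; _+_; _*_; _≤_; _<_; z≤n; s≤s; _≟_; _≤?_)
open import Data.Nat.Properties
  using ( ≤-refl; ≤-reflexive; ≤-trans; m≤m+n; m≤n+m; m≤n⇒m≤1+n; m≤n⇒m⊓n≡m; pred-mono-≤; ≰⇒>; <⇒≢
        ; +-suc; +-assoc; +-cancelˡ-≡; +-mono-<; suc-injective; ≡-irrelevant)
open import Data.Product using (Σ; _×_; _,_; proj₁; proj₂)
open import Data.Sum using (_⊎_; inj₁; inj₂)
open import Data.Sum.Properties using (inj₁-injective; inj₂-injective)
open import Data.Vec using ([]; _∷_; here; there)
open import Data.Vec.Properties.WithK using ([]=-irrelevant)
open import Function using (_∘_; id; Equivalence; _⇔_; mk⇔)
open import Function.Definitions using (Injective)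
open import Relation.Nullary using (yes; no; contradiction)
open import Relation.Binary.PropositionalEquality
  using (_≡_; refl; sym; trans; cong; cong₂; subst; subst₂; module ≡-Reasoning)

open import Defs

private variable A : Set

nth : List A → ℕ → Maybe A
nth []       _       = nothing
nth (x ∷ xs) zero    = just x
nth (x ∷ xs) (suc i) = nth xs i

nth-∈zip : ∀ {B : Set} {ps : List (A × B)} {a b} → (a , b) ∈ ps →
           Σ ℕ λ i → nth (map proj₁ ps) i ≡ just a × nth (map proj₂ ps) i ≡ just b
nth-∈zip (here refl) = zero , refl , refl
nth-∈zip (there p)   = let i , eq₁ , eq₂ = nth-∈zip p in suc i , eq₁ , eq₂

nth-applyUpTo : ∀ (f : ℕ → A) k {i x} → nth (applyUpTo f k) i ≡ just x → i < k × f i ≡ x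
nth-applyUpTo f (suc k) {zero}  refl = s≤s z≤n , refl
nth-applyUpTo f (suc k) {suc i} eq   = let i<k , fi≡x = nth-applyUpTo (f ∘ suc) k eq in s≤s i<k , fi≡x

map-proj₁-zip : ∀ {B : Set} (xs : List A) (ys : List B) → length xs ≤ length ys →
                map proj₁ (zip xs ys) ≡ xs
map-proj₁-zip []       _        _         = refl
map-proj₁-zip (x ∷ xs) (y ∷ ys) (s≤s ≤∣ys∣) = cong (x ∷_) (map-proj₁-zip xs ys ≤∣ys∣)

map-proj₂-zip-⊆ : ∀ {B : Set} (xs : List A) (ys : List B) → map proj₂ (zip xs ys) ⊆ ys
map-proj₂-zip-⊆ []       ys       = minimum ys
map-proj₂-zip-⊆ (x ∷ xs) []       = []
map-proj₂-zip-⊆ (x ∷ xs) (y ∷ ys) = refl ∷ map-proj₂-zip-⊆ xs ys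

unique-⊆ : {xs ys : List A} → xs ⊆ ys → Unique ys → Unique xs
unique-⊆ []         []          = []
unique-⊆ (_ ∷ʳ τ)   (_ ∷ u)     = unique-⊆ τ u
unique-⊆ (refl ∷ τ) (x≢ys ∷ u)  = All-resp-⊆ τ x≢ys ∷ unique-⊆ τ u

unique-++⁻ʳ : ∀ xs {ys : List A} → Unique (xs ++ ys) → Unique ys
unique-++⁻ʳ []       u       = u
unique-++⁻ʳ (_ ∷ xs) (_ ∷ u) = unique-++⁻ʳ xs u

unique-++∷⁻ʳ : ∀ xs {y} {ys : List A} → Unique (xs ++ y ∷ ys) → Unique ys
unique-++∷⁻ʳ xs = AllPairs.tail ∘ unique-++⁻ʳ xs

unique-++∷⇒∉ʳ : ∀ xs {y} {ys : List A} → Unique (xs ++ y ∷ ys) → y ∉ ys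
unique-++∷⇒∉ʳ xs = Unique[x∷xs]⇒x∉xs ∘ unique-++⁻ʳ xs

unique-++⇒∉ˡ : ∀ xs {ys : List A} {y} → Unique (xs ++ ys) → y ∈ ys → y ∉ xs
unique-++⇒∉ˡ (x ∷ xs) (x≢ ∷ _) y∈ys (here refl)  = All.lookup x≢ (∈-++⁺ʳ xs y∈ys) refl
unique-++⇒∉ˡ (x ∷ xs) (_ ∷ u)  y∈ys (there y∈xs) = unique-++⇒∉ˡ xs u y∈ys y∈xs

-- Ramsey's theorem for sublists

-- A length-k sublist of H is a k-subset of H together with the order it inherits from H,
-- which the colouring c may use.
Monochromatic : ℕ → (List A → Bool) → Bool → List A → Set
Monochromatic k c col H = ∀ X → X ⊆ H → length X ≡ k → c X ≡ col

Monochromatic-⊆ : ∀ {k c col} {H H′ : List A} → H′ ⊆ H →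
                  Monochromatic k c col H → Monochromatic k c col H′
Monochromatic-⊆ H′⊆H mono X X⊆H′ = mono X (⊆-trans X⊆H′ H′⊆H)

Monochromatic-∷ : ∀ {k c col x} {H H′ : List A} → H ⊆ H′ →
                  Monochromatic k (λ X → c (x ∷ X)) col H′ →
                  Monochromatic (suc k) c col H → Monochromatic (suc k) c col (x ∷ H)
Monochromatic-∷ H⊆H′ monoₓ mono X       (_ ∷ʳ X⊆H)   = mono X X⊆H
Monochromatic-∷ H⊆H′ monoₓ mono (_ ∷ X) (refl ∷ X⊆H) = monoₓ X (⊆-trans X⊆H H⊆H′) ∘ suc-injective

sublistOfLength : ∀ p (L : List A) → p ≤ length L → Σ (List A) λ H → H ⊆ L × length H ≡ p
sublistOfLength p L p≤∣L∣ = take p L , take-⊆ p L , trans (length-take p L) (m≤n⇒m⊓n≡m p≤∣L∣)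

RamseyBound : ℕ → ℕ → ℕ → ℕ → Set₁
RamseyBound k p q N = ∀ {A : Set} (L : List A) → N ≤ length L → (c : List A → Bool) →
  Σ (List A) λ H → H ⊆ L ×
    (length H ≡ p × Monochromatic k c true H ⊎ length H ≡ q × Monochromatic k c false H)

Ramsey : ℕ → ℕ → ℕ → Set₁
Ramsey k p q = Σ ℕ (RamseyBound k p q)

ramsey-zero : ∀ p q → Ramsey 0 p q
ramsey-zero p q = p + q , monochromatic
  where
  monochromatic : RamseyBound 0 p q (p + q)
  monochromatic L p+q≤∣L∣ c with c [] in c[]≡
  ... | true  = let H , H⊆L , ∣H∣≡p = sublistOfLength p L (≤-trans (m≤m+n p q) p+q≤∣L∣)
                in H , H⊆L , inj₁ (∣H∣≡p , λ { [] _ _ → c[]≡ })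
  ... | false = let H , H⊆L , ∣H∣≡q = sublistOfLength q L (≤-trans (m≤n+m q p) p+q≤∣L∣)
                in H , H⊆L , inj₂ (∣H∣≡q , λ { [] _ _ → c[]≡ })

-- Erdős–Rado: past the first element x, find a large sublist on which c (x ∷ _) is monochromatic.
ramsey-suc : ∀ {k} → (∀ p q → Ramsey k p q) → ∀ p q → Ramsey (suc k) p q
ramsey-suc ramseyₖ zero q = 0 , λ L _ c → [] , minimum L , inj₁ (refl , λ { [] [] () })
ramsey-suc ramseyₖ (suc p) zero = 0 , λ L _ c → [] , minimum L , inj₂ (refl , λ { [] [] () })
ramsey-suc {k} ramseyₖ (suc p) (suc q) = suc N , monochromatic
  where
  R₁ = ramsey-suc ramseyₖ p (suc q)
  R₂ = ramsey-suc ramseyₖ (suc p) q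
  M = proj₁ R₁ + proj₁ R₂
  N = proj₁ (ramseyₖ M M)
  monochromatic : RamseyBound (suc k) (suc p) (suc q) (suc N)
  monochromatic (x ∷ L) (s≤s N≤∣L∣) c with proj₂ (ramseyₖ M M) L N≤∣L∣ (λ X → c (x ∷ X))
  ... | H′ , H′⊆L , inj₁ (∣H′∣≡M , monoₓ)
      with proj₂ R₁ H′ (subst (proj₁ R₁ ≤_) (sym ∣H′∣≡M) (m≤m+n _ _)) c
  ...   | H , H⊆H′ , inj₁ (∣H∣≡p , mono) =
          x ∷ H , refl ∷ ⊆-trans H⊆H′ H′⊆L , inj₁ (cong suc ∣H∣≡p , Monochromatic-∷ H⊆H′ monoₓ mono)
  ...   | H , H⊆H′ , inj₂ (∣H∣≡q , mono) = H , x ∷ʳ ⊆-trans H⊆H′ H′⊆L , inj₂ (∣H∣≡q , mono)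
  monochromatic (x ∷ L) (s≤s N≤∣L∣) c | H′ , H′⊆L , inj₂ (∣H′∣≡M , monoₓ)
      with proj₂ R₂ H′ (subst (proj₁ R₂ ≤_) (sym ∣H′∣≡M) (m≤n+m _ _)) c
  ...   | H , H⊆H′ , inj₁ (∣H∣≡p , mono) = H , x ∷ʳ ⊆-trans H⊆H′ H′⊆L , inj₁ (∣H∣≡p , mono)
  ...   | H , H⊆H′ , inj₂ (∣H∣≡q , mono) =
          x ∷ H , refl ∷ ⊆-trans H⊆H′ H′⊆L , inj₂ (cong suc ∣H∣≡q , Monochromatic-∷ H⊆H′ monoₓ mono)

ramsey : ∀ k p q → Ramsey k p q
ramsey zero    = ramsey-zero
ramsey (suc k) = ramsey-suc (ramsey k)

MonochromaticBound : ℕ → ℕ → ℕ → Set₁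
MonochromaticBound k p N = ∀ {A : Set} (L : List A) → N ≤ length L → (c : List A → Bool) →
  Σ (List A) λ H → H ⊆ L × length H ≡ p × Σ Bool λ col → Monochromatic k c col H

monochromaticSublist : ∀ k p → Σ ℕ (MonochromaticBound k p)
monochromaticSublist k p = proj₁ (ramsey k p p) , monochromatic
  where
  monochromatic : MonochromaticBound k p (proj₁ (ramsey k p p))
  monochromatic L N≤∣L∣ c with proj₂ (ramsey k p p) L N≤∣L∣ c
  ... | H , H⊆L , inj₁ (∣H∣≡p , mono) = H , H⊆L , ∣H∣≡p , true , mono
  ... | H , H⊆L , inj₂ (∣H∣≡p , mono) = H , H⊆L , ∣H∣≡p , false , mono

SimultaneousBound : ℕ → ℕ → ℕ → ℕ → Set₁
SimultaneousBound k r p N = ∀ {A : Set} (L : List A) → N ≤ length L → (cs : ℕ → List A → Bool) →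
  Σ (List A) λ H → H ⊆ L × length H ≡ p ×
    Σ (ℕ → Bool) λ v → ∀ i → i < r → Monochromatic k (cs i) (v i) H

simultaneousRamsey : ∀ k r p → Σ ℕ (SimultaneousBound k r p)
simultaneousRamsey k zero p = p , λ L p≤∣L∣ cs →
  let H , H⊆L , ∣H∣≡p = sublistOfLength p L p≤∣L∣ in H , H⊆L , ∣H∣≡p , (λ _ → true) , λ _ ()
simultaneousRamsey k (suc r) p = proj₁ (monochromaticSublist k N) , monochromatic
  where
  N = proj₁ (simultaneousRamsey k r p)
  monochromatic : SimultaneousBound k (suc r) p (proj₁ (monochromaticSublist k N))
  monochromatic L N₀≤∣L∣ cs with proj₂ (monochromaticSublist k N) L N₀≤∣L∣ (cs 0)
  ... | H₀ , H₀⊆L , ∣H₀∣≡N , col , mono₀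
      with proj₂ (simultaneousRamsey k r p) H₀ (≤-reflexive (sym ∣H₀∣≡N)) (λ i → cs (suc i))
  ... | H , H⊆H₀ , ∣H∣≡p , v , mono = H , ⊆-trans H⊆H₀ H₀⊆L , ∣H∣≡p , v′ , mono′
    where
    v′ : ℕ → Bool
    v′ zero    = col
    v′ (suc i) = v i
    mono′ : ∀ i → i < suc r → Monochromatic k (cs i) (v′ i) H
    mono′ zero    _         = Monochromatic-⊆ H⊆H₀ mono₀
    mono′ (suc i) (s≤s i<r) = mono i i<r

-- Colouring k-subsets of [n] by positions

toSubset : ∀ {n} → List (Fin n) → Subset n
toSubset []      = ∅
toSubset (x ∷ X) = ⁅ x ⁆ ∪ toSubset X

module _ {n} {x : Fin n} where

  ∈-toSubset⁺ : ∀ {X} → x ∈ X → x ∈ₛ toSubset X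
  ∈-toSubset⁺ (here refl) = x∈p∪q⁺ (inj₁ (x∈⁅x⁆ x))
  ∈-toSubset⁺ (there x∈X) = x∈p∪q⁺ (inj₂ (∈-toSubset⁺ x∈X))

  ∈-toSubset⁻ : ∀ X → x ∈ₛ toSubset X → x ∈ X
  ∈-toSubset⁻ []      x∈∅ = contradiction x∈∅ ∉⊥
  ∈-toSubset⁻ (y ∷ X) x∈X with x∈p∪q⁻ ⁅ y ⁆ (toSubset X) x∈X
  ... | inj₁ x∈⁅y⁆ = here (x∈⁅y⁆⇒x≡y y x∈⁅y⁆)
  ... | inj₂ x∈X′  = there (∈-toSubset⁻ X x∈X′)

∣⁅x⁆∪p∣≡1+∣p∣ : ∀ {n} (x : Fin n) (p : Subset n) → x ∉ₛ p → ∣ ⁅ x ⁆ ∪ p ∣ ≡ suc ∣ p ∣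
∣⁅x⁆∪p∣≡1+∣p∣ zero    (true  ∷ p) x∉p = contradiction here x∉p
∣⁅x⁆∪p∣≡1+∣p∣ zero    (false ∷ p) x∉p = cong (suc ∘ ∣_∣) (∪-identityˡ p)
∣⁅x⁆∪p∣≡1+∣p∣ (suc x) (true  ∷ p) x∉p = cong suc (∣⁅x⁆∪p∣≡1+∣p∣ x p (x∉p ∘ there))
∣⁅x⁆∪p∣≡1+∣p∣ (suc x) (false ∷ p) x∉p = ∣⁅x⁆∪p∣≡1+∣p∣ x p (x∉p ∘ there)

∣toSubset∣ : ∀ {n} {X : List (Fin n)} → Unique X → ∣ toSubset X ∣ ≡ length X
∣toSubset∣ {n} {X = []} _         = ∣⊥∣≡0 n
∣toSubset∣ {X = x ∷ X} u@(_ ∷ u′) = trans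
  (∣⁅x⁆∪p∣≡1+∣p∣ x (toSubset X) (Unique[x∷xs]⇒x∉xs u ∘ ∈-toSubset⁻ X))
  (cong suc (∣toSubset∣ u′))

module _ {n k} (χ : Colouring n k) where

  edgeColourIn : List (Fin n) → Fin n → Bool
  edgeColourIn X x with ∣ toSubset X ∣ ≟ k | x ∈? toSubset X
  ... | yes ∣X∣≡k | yes x∈X = χ x (toSubset X , ∣X∣≡k) x∈X
  ... | _         | _       = false

  -- Junk value false when X is not a k-set or has no i-th element.
  positionColour : ℕ → List (Fin n) → Bool
  positionColour i X = maybe (edgeColourIn X) false (nth X i)

  positionColour-nth : ∀ {i X x} (∣X∣≡k : ∣ toSubset X ∣ ≡ k) → nth X i ≡ just x →
                       (x∈X : x ∈ₛ toSubset X) → positionColour i X ≡ χ x (toSubset X , ∣X∣≡k) x∈X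
  positionColour-nth {i} {X} {x} ∣X∣≡k Xᵢ≡x x∈X rewrite Xᵢ≡x
    with ∣ toSubset X ∣ ≟ k | x ∈? toSubset X
  ... | yes e | yes q rewrite ≡-irrelevant e ∣X∣≡k | []=-irrelevant q x∈X = refl
  ... | no e≢ | _     = contradiction ∣X∣≡k e≢
  ... | yes _ | no q∉ = contradiction x∈X q∉

trues : List Bool → ℕ
trues []          = 0
trues (true ∷ w)  = suc (trues w)
trues (false ∷ w) = trues w

trues+trues∘not : ∀ w → trues w + trues (map not w) ≡ length w
trues+trues∘not []          = refl
trues+trues∘not (true ∷ w)  = cong suc (trues+trues∘not w)
trues+trues∘not (false ∷ w) = trans (+-suc (trues w) _) (cong suc (trues+trues∘not w))

matching : Bool → List Bool → List Bool
matching true  w = w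
matching false w = map not w

nth-matching : ∀ c w {i} → nth (matching c w) i ≡ just true → nth w i ≡ just c
nth-matching true  w           eq = eq
nth-matching false (false ∷ w) {zero}  eq = refl
nth-matching false (x ∷ w)     {suc i} eq = nth-matching false w eq

length-matching : ∀ c w → length (matching c w) ≡ length w
length-matching true  w = refl
length-matching false w = length-map not w

pigeonhole : ∀ b w → length w ≡ b + b → Σ Bool λ c → b ≤ trues (matching c w)
pigeonhole b w ∣w∣≡b+b with b ≤? trues w | b ≤? trues (map not w)
... | yes b≤ | _      = true , b≤
... | no _   | yes b≤ = false , b≤
... | no b≰  | no b≰′ =
  contradiction (trans (trues+trues∘not w) ∣w∣≡b+b) (<⇒≢ (+-mono-< (≰⇒> b≰) (≰⇒> b≰′)))

leadingFalses : List Bool → ℕ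
leadingFalses (false ∷ m) = suc (leadingFalses m)
leadingFalses _           = 0

afterFirstTrue : List Bool → List Bool
afterFirstTrue []          = []
afterFirstTrue (true ∷ m)  = m
afterFirstTrue (false ∷ m) = afterFirstTrue m

firstTrue-split : ∀ m → 1 ≤ trues m → replicate (leadingFalses m) false ++ true ∷ afterFirstTrue m ≡ m
firstTrue-split (true ∷ m)  _  = refl
firstTrue-split (false ∷ m) 1≤ = cong (false ∷_) (firstTrue-split m 1≤)

leadingFalses≤length : ∀ m → leadingFalses m ≤ length m
leadingFalses≤length []          = z≤n
leadingFalses≤length (true ∷ m)  = z≤n
leadingFalses≤length (false ∷ m) = s≤s (leadingFalses≤length m)

length-afterFirstTrue : ∀ m → length (afterFirstTrue m) ≤ length m
length-afterFirstTrue []          = z≤n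
length-afterFirstTrue (true ∷ m)  = m≤n⇒m≤1+n ≤-refl
length-afterFirstTrue (false ∷ m) = m≤n⇒m≤1+n (length-afterFirstTrue m)

trues-afterFirstTrue : ∀ m → trues (afterFirstTrue m) ≡ pred (trues m)
trues-afterFirstTrue []          = refl
trues-afterFirstTrue (true ∷ m)  = refl
trues-afterFirstTrue (false ∷ m) = trues-afterFirstTrue m

-- A layout splits H as F₀ ++ s₀ ∷ F₁ ++ s₁ ∷ ⋯ ++ s₍ₐ₋₁₎ ∷ Fₐ with filler blocks Fᵢ of length k;
-- the special elements sᵢ become the images of the left vertices of B_{a,b}.
data Layout {A : Set} (k : ℕ) : ℕ → List A → Set where
  final : ∀ {F} → length F ≡ k → Layout k 0 F
  block : ∀ {a H} F s → length F ≡ k → Layout k a H → Layout k (suc a) (F ++ s ∷ H)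

splitAround : ∀ k (H : List A) → k < length H →
              Σ (List A) λ F → Σ A λ s → Σ (List A) λ H′ → length F ≡ k × F ++ s ∷ H′ ≡ H
splitAround zero    (s ∷ H) _         = [] , s , H , refl , refl
splitAround (suc k) (x ∷ H) (s≤s k<∣H∣) =
  let F , s , H′ , ∣F∣≡k , eq = splitAround k H k<∣H∣ in x ∷ F , s , H′ , cong suc ∣F∣≡k , cong (x ∷_) eq

length-afterBlock : ∀ k a (F : List A) s H → length F ≡ k →
                    length (F ++ s ∷ H) ≡ suc a * suc k + k → length H ≡ a * suc k + k
length-afterBlock k a F s H ∣F∣≡k ∣FsH∣≡ = +-cancelˡ-≡ k _ _ (suc-injective (begin
  suc (k + length H)         ≡⟨ +-suc k (length H) ⟨
  k + length (s ∷ H)         ≡⟨ cong (_+ length (s ∷ H)) ∣F∣≡k ⟨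
  length F + length (s ∷ H)  ≡⟨ length-++ F ⟨
  length (F ++ s ∷ H)        ≡⟨ ∣FsH∣≡ ⟩
  suc (k + a * suc k + k)    ≡⟨ cong suc (+-assoc k (a * suc k) k) ⟩
  suc (k + (a * suc k + k))  ∎))
  where open ≡-Reasoning

layout : ∀ k a (H : List A) → length H ≡ a * suc k + k → Layout k a H
layout k zero    H ∣H∣≡ = final ∣H∣≡
layout k (suc a) H ∣H∣≡
  with splitAround k H (subst (k <_) (sym ∣H∣≡) (s≤s (≤-trans (m≤m+n k _) (m≤m+n _ k))))
... | F , s , H′ , ∣F∣≡k , refl = block F s ∣F∣≡k (layout k a H′ (length-afterBlock k a F s H′ ∣F∣≡k ∣H∣≡))

fillersBefore : List Bool → List A → List (Bool × A)
fillersBefore m F = zip (replicate (leadingFalses m) false) F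

module _ {k : ℕ} where

  special : ∀ {a} {H : List A} → Layout k a H → Fin a → A
  special (block F s _ L) zero    = s
  special (block F s _ L) (suc x) = special L x

  special-∈ : ∀ {a} {H : List A} (L : Layout k a H) x → special L x ∈ H
  special-∈ (block F s _ L) zero    = ∈-++⁺ʳ F (here refl)
  special-∈ (block F s _ L) (suc x) = ∈-++⁺ʳ F (there (special-∈ L x))

  special-injective : ∀ {a} {H : List A} (L : Layout k a H) → Unique H →
                      ∀ {x y} → special L x ≡ special L y → x ≡ y
  special-injective (block F s _ L) u {zero}  {zero}  _  = refl
  special-injective (block F s _ L) u {zero}  {suc y} eq =
    contradiction (subst (_∈ _) (sym eq) (special-∈ L y)) (unique-++∷⇒∉ʳ F u)
  special-injective (block F s _ L) u {suc x} {zero}  eq =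
    contradiction (subst (_∈ _) eq (special-∈ L x)) (unique-++∷⇒∉ʳ F u)
  special-injective (block F s _ L) u {suc x} {suc y} eq =
    cong suc (special-injective L (unique-++∷⁻ʳ F u) eq)

  -- select L m Y lists elements of H tagged by the entries of the pattern m: the special element
  -- of each y ∈ Y takes the next true position, the false positions before it are filled from
  -- the block of y, and the positions after the last y from the final block.
  select : ∀ {a} {H : List A} → Layout k a H → List Bool → Subset a → List (Bool × A)
  select (final {F} _)   m []          = zip m F
  select (block F s _ L) m (false ∷ Y) = select L m Y
  select (block F s _ L) m (true ∷ Y)  =
    fillersBefore m F ++ (true , s) ∷ select L (afterFirstTrue m) Y

  select-⊆ : ∀ {a} {H : List A} (L : Layout k a H) m Y → map proj₂ (select L m Y) ⊆ H
  select-⊆ (final {F} _)   m []          = map-proj₂-zip-⊆ m F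
  select-⊆ (block F s _ L) m (false ∷ Y) = ++⁺ˡ F (s ∷ʳ select-⊆ L m Y)
  select-⊆ (block F s _ L) m (true ∷ Y)  = subst (_⊆ F ++ s ∷ _) (sym (map-++ proj₂ (fillersBefore m F) _))
    (++⁺ (map-proj₂-zip-⊆ _ F) (refl ∷ select-⊆ L (afterFirstTrue m) Y))

  select-pattern : ∀ {a} {H : List A} (L : Layout k a H) m Y → length m ≤ k → ∣ Y ∣ ≤ trues m →
                   map proj₁ (select L m Y) ≡ m
  select-pattern (final {F} ∣F∣≡k) m [] ∣m∣≤k _ = map-proj₁-zip m F (subst (length m ≤_) (sym ∣F∣≡k) ∣m∣≤k)
  select-pattern (block F s _ L) m (false ∷ Y) ∣m∣≤k ∣Y∣≤ = select-pattern L m Y ∣m∣≤k ∣Y∣≤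
  select-pattern (block F s ∣F∣≡k L) m (true ∷ Y) ∣m∣≤k ∣Y∣< = begin
    map proj₁ (fillersBefore m F ++ (true , s) ∷ select L m′ Y)
      ≡⟨ map-++ proj₁ (fillersBefore m F) _ ⟩
    map proj₁ (fillersBefore m F) ++ true ∷ map proj₁ (select L m′ Y)
      ≡⟨ cong₂ (λ xs ys → xs ++ true ∷ ys) (map-proj₁-zip R F ∣R∣≤∣F∣) (select-pattern L m′ Y ∣m′∣≤k ∣Y∣≤) ⟩
    R ++ true ∷ m′
      ≡⟨ firstTrue-split m (≤-trans (s≤s z≤n) ∣Y∣<) ⟩
    m ∎
    where
    open ≡-Reasoning
    R  = replicate (leadingFalses m) false
    m′ = afterFirstTrue m
    ∣R∣≤∣F∣ : length R ≤ length F
    ∣R∣≤∣F∣ = subst₂ _≤_ (sym (length-replicate _)) (sym ∣F∣≡k) (≤-trans (leadingFalses≤length m) ∣m∣≤k)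
    ∣m′∣≤k : length m′ ≤ k
    ∣m′∣≤k = ≤-trans (length-afterFirstTrue m) ∣m∣≤k
    ∣Y∣≤ : ∣ Y ∣ ≤ trues m′
    ∣Y∣≤ = subst (∣ Y ∣ ≤_) (sym (trues-afterFirstTrue m)) (pred-mono-≤ ∣Y∣<)

  select-special : ∀ {a} {H : List A} (L : Layout k a H) m {Y x} → x ∈ₛ Y →
                   (true , special L x) ∈ select L m Y
  select-special (block F s _ L) m {true ∷ Y}  here       = ∈-++⁺ʳ _ (here refl)
  select-special (block F s _ L) m {true ∷ Y}  (there x∈Y) = ∈-++⁺ʳ _ (there (select-special L _ x∈Y))
  select-special (block F s _ L) m {false ∷ Y} (there x∈Y) = select-special L m x∈Y

  select-special⁻ : ∀ {a} {H : List A} (L : Layout k a H) m Y → Unique H →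
                    ∀ {x} → special L x ∈ map proj₂ (select L m Y) → x ∈ₛ Y
  select-special⁻ (block F s _ L) m (false ∷ Y) u {zero} s∈ =
    contradiction (lookup (select-⊆ L m Y) s∈) (unique-++∷⇒∉ʳ F u)
  select-special⁻ (block F s _ L) m (false ∷ Y) u {suc x} sₓ∈ =
    there (select-special⁻ L m Y (unique-++∷⁻ʳ F u) sₓ∈)
  select-special⁻ (block F s _ L) m (true ∷ Y)  u {zero}  _   = here
  select-special⁻ (block F s _ L) m (true ∷ Y)  u {suc x} sₓ∈
    with ∈-++⁻ (map proj₂ (fillersBefore m F)) (subst (_ ∈_) (map-++ proj₂ (fillersBefore m F) _) sₓ∈)
  ... | inj₁ ∈fillers =
    contradiction (lookup (map-proj₂-zip-⊆ _ F) ∈fillers) (unique-++⇒∉ˡ F u (there (special-∈ L x)))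
  ... | inj₂ (here eq) = contradiction (subst (_∈ _) eq (special-∈ L x)) (unique-++∷⇒∉ʳ F u)
  ... | inj₂ (there ∈rest) = there (select-special⁻ L _ Y (unique-++∷⁻ʳ F u) ∈rest)

-- The induced monochromatic copy

module InducedCopy {a b n : ℕ} (χ : Colouring n (b + b)) {H : List (Fin n)} (unique-H : Unique H)
  (L : Layout (b + b) a H) (v : ℕ → Bool)
  (mono : ∀ i → i < b + b → Monochromatic (b + b) (positionColour χ i) (v i) H)
  (c : Bool) (b≤trues : b ≤ trues (matching c (applyUpTo v (b + b)))) where

  k = b + b
  m = matching c (applyUpTo v k)

  m-colour : ∀ {i} → nth m i ≡ just true → i < k × v i ≡ c
  m-colour = nth-applyUpTo v k ∘ nth-matching c (applyUpTo v k)

  pairs : KSubset a b → List (Bool × Fin n)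
  pairs (Y , _) = select L m Y

  members : KSubset a b → List (Fin n)
  members Y = map proj₂ (pairs Y)

  members-⊆ : ∀ Y → members Y ⊆ H
  members-⊆ (Y , _) = select-⊆ L m Y

  pattern-pairs : ∀ Y → map proj₁ (pairs Y) ≡ m
  pattern-pairs (Y , ∣Y∣≡b) = select-pattern L m Y
    (≤-reflexive (trans (length-matching c _) (length-applyUpTo v k)))
    (subst (_≤ trues m) (sym ∣Y∣≡b) b≤trues)

  length-members : ∀ Y → length (members Y) ≡ k
  length-members Y = begin
    length (map proj₂ (pairs Y))   ≡⟨ length-map proj₂ (pairs Y) ⟩
    length (pairs Y)               ≡⟨ length-map proj₁ (pairs Y) ⟨
    length (map proj₁ (pairs Y))   ≡⟨ cong length (pattern-pairs Y) ⟩
    length m                       ≡⟨ length-matching c _ ⟩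
    length (applyUpTo v k)         ≡⟨ length-applyUpTo v k ⟩
    k                              ∎
    where open ≡-Reasoning

  ∣members∣ : ∀ Y → ∣ toSubset (members Y) ∣ ≡ k
  ∣members∣ Y = trans (∣toSubset∣ (unique-⊆ (members-⊆ Y) unique-H)) (length-members Y)

  image : KSubset a b → KSubset n k
  image Y = toSubset (members Y) , ∣members∣ Y

  s : Fin a → Fin n
  s = special L

  ∈-image : ∀ x Y → x ∈ₛ proj₁ Y ⇔ s x ∈ₛ proj₁ (image Y)
  ∈-image x (Y , _) = mk⇔
    (λ x∈Y → ∈-toSubset⁺ (∈-map⁺ proj₂ (select-special L m x∈Y)))
    (λ sx∈ → select-special⁻ L m Y unique-H (∈-toSubset⁻ _ sx∈))

  image-colour : ∀ {x} Y → x ∈ₛ proj₁ Y → (sx∈ : s x ∈ₛ proj₁ (image Y)) → χ (s x) (image Y) sx∈ ≡ c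
  image-colour {x} Y x∈Y sx∈
    with nth-∈zip (select-special L m {proj₁ Y} x∈Y)
  ... | i , mᵢ≡true , Xᵢ≡sx
    with m-colour (subst (λ m′ → nth m′ i ≡ just true) (pattern-pairs Y) mᵢ≡true)
  ... | i<k , vᵢ≡c = begin
    χ (s x) (image Y) sx∈           ≡⟨ positionColour-nth χ {i} {members Y} (∣members∣ Y) Xᵢ≡sx sx∈ ⟨
    positionColour χ i (members Y)  ≡⟨ mono i i<k (members Y) (members-⊆ Y) (length-members Y) ⟩
    v i                             ≡⟨ vᵢ≡c ⟩
    c                               ∎
    where open ≡-Reasoning

  image-⊆ : ∀ {Y Y′} → image Y ≡ image Y′ → ∀ {x} → x ∈ₛ proj₁ Y → x ∈ₛ proj₁ Y′
  image-⊆ {Y} {Y′} eq {x} =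
    Equivalence.from (∈-image x Y′) ∘ subst (λ Z → s x ∈ₛ proj₁ Z) eq ∘ Equivalence.to (∈-image x Y)

  image-injective : ∀ {Y Y′} → image Y ≡ image Y′ → Y ≡ Y′
  image-injective {Y , ∣Y∣≡b} {Y′ , ∣Y′∣≡b} eq with ⊆-antisym (image-⊆ eq) (image-⊆ (sym eq))
  ... | refl = cong (Y ,_) (≡-irrelevant ∣Y∣≡b ∣Y′∣≡b)

  embedding : Vertex a b → Vertex n k
  embedding (inj₁ x) = inj₁ (s x)
  embedding (inj₂ Y) = inj₂ (image Y)

  embedding-injective : Injective _≡_ _≡_ embedding
  embedding-injective {inj₁ x} {inj₁ x′} eq = cong inj₁ (special-injective L unique-H (inj₁-injective eq))
  embedding-injective {inj₂ Y} {inj₂ Y′} eq = cong inj₂ (image-injective (inj₂-injective eq))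

  embedding-adj : ∀ u w → Adj u w ⇔ Adj (embedding u) (embedding w)
  embedding-adj (inj₁ x) (inj₁ _) = mk⇔ id id
  embedding-adj (inj₂ Y) (inj₂ _) = mk⇔ id id
  embedding-adj (inj₁ x) (inj₂ Y) = ∈-image x Y
  embedding-adj (inj₂ Y) (inj₁ x) = ∈-image x Y

  embedding-colour : ∀ u w (p : Adj (embedding u) (embedding w)) →
                     edgeColour χ (embedding u) (embedding w) p ≡ c
  embedding-colour (inj₁ x) (inj₂ Y) p = image-colour Y (Equivalence.from (∈-image x Y) p) p
  embedding-colour (inj₂ Y) (inj₁ x) p = image-colour Y (Equivalence.from (∈-image x Y) p) p

  inducedMonoCopy : InducedMonoCopy a b χ
  inducedMonoCopy = embedding , (embedding-injective , embedding-adj) , c , embedding-colour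

theorem13 : (a b : ℕ) → b ≤ a →
    Σ ℕ λ n → Σ ℕ λ k → k ≤ n ×
      ((c : Colouring n k) → InducedMonoCopy a b c)
theorem13 a b _ = n , k , m≤n+m k N , inducedMonoCopy
  where
  k = b + b
  R = simultaneousRamsey k k (a * suc k + k)
  N = proj₁ R
  n = N + k
  inducedMonoCopy : (χ : Colouring n k) → InducedMonoCopy a b χ
  inducedMonoCopy χ
    with proj₂ R (allFin n) (subst (N ≤_) (sym (length-tabulate id)) (m≤m+n N k)) (positionColour χ)
  ... | H , H⊆[n] , ∣H∣≡ , v , mono
    with pigeonhole b (applyUpTo v k) (length-applyUpTo v k)
  ... | c , b≤trues =
    InducedCopy.inducedMonoCopy χ (unique-⊆ H⊆[n] (allFin⁺ n)) (layout k a H ∣H∣≡) v mono c b≤trues
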